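{- Let $G$ be a finite, undirected, connected graph (possibly with loops and multi-edges) with $n$ nodes and $m$ edges, in which every node has degree at least $2$, and suppose $G$ contains at least two cycles. Then the eigenvalue $1$ of the non-backtracking matrix $\mathbf{B}$ of $G$ has geometric multiplicity $\dim\ker(\mathbf{B}-\mathbf{I})=m-n+1$.
   Context: Each edge with endpoints $u,v$ (possibly $u=v$) yields two oriented edges; for an oriented edge $e$ write $s(e),t(e)$ for its source and target and $\bar e$ for the opposite orientation of the same edge. The non-backtracking matrix $\mathbf{B}$ is indexed by oriented edges with $\mathbf{B}_{f,e}=1$ if $t(e)=s(f)$ and $f\neq\bar e$, and $0$ otherwise. Degrees count a loop twice. -}

module Defs where

open import Data.Nat using (ℕ; zero; suc; _≤_)
open import Data.Fin using (Fin; zero; suc) renaming (_≟_ to _≟ᶠ_)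
open import Data.Bool using (Bool; true; false; not; if_then_else_; _∧_) renaming (_≟_ to _≟ᵇ_)
open import Data.Product using (Σ; _×_; _,_; proj₁; proj₂; ∃)
open import Data.Product.Properties using (≡-dec)
open import Data.List using (List; []; _∷_; map; length)
open import Data.List.Membership.Propositional using (_∈_)
open import Data.List.Relation.Unary.Unique.Propositional using (Unique)
open import Data.Rational using (ℚ; 0ℚ; 1ℚ; _+_; _*_)
open import Relation.Nullary using (¬_; does; Dec)
open import Data.Unit using (⊤)
open import Relation.Binary.PropositionalEquality using (_≡_; _≢_)
open import Function.Bundles using (_⇔_)

-- A finite multigraph (loops and multi-edges allowed): n nodes (Fin n),
-- m edges (Fin m), each edge having an (unordered) pair of endpoints,
-- stored in an arbitrary order.
record Graph : Set where
  field
    n : ℕ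
    m : ℕ
    ends : Fin m → Fin n × Fin n
open Graph public

Node : Graph → Set
Node G = Fin (n G)

Edge : Graph → Set
Edge G = Fin (m G)

-- Oriented edges: each edge yields two orientations (also for loops).
OEdge : Graph → Set
OEdge G = Edge G × Bool

src : (G : Graph) → OEdge G → Node G
src G (e , true)  = proj₁ (ends G e)
src G (e , false) = proj₂ (ends G e)

tgt : (G : Graph) → OEdge G → Node G
tgt G (e , true)  = proj₂ (ends G e)
tgt G (e , false) = proj₁ (ends G e)

rev : (G : Graph) → OEdge G → OEdge G
rev G (e , b) = (e , not b)

ΣFin : (k : ℕ) → (Fin k → ℚ) → ℚ
ΣFin zero    f = 0ℚ
ΣFin (suc k) f = f zero + ΣFin k (λ i → f (suc i))

ΣOE : (G : Graph) → (OEdge G → ℚ) → ℚ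
ΣOE G g = ΣFin (m G) (λ e → g (e , true) + g (e , false))

ΣFinℕ : (k : ℕ) → (Fin k → ℕ) → ℕ
ΣFinℕ zero    f = zero
ΣFinℕ (suc k) f = f zero Data.Nat.+ ΣFinℕ k (λ i → f (suc i))

indicator : Bool → ℕ
indicator b = if b then 1 else 0

-- degree = number of oriented edges with source v (so a loop counts twice)
degree : (G : Graph) → Node G → ℕ
degree G v = ΣFinℕ (m G) (λ e →
  indicator (does (src G (e , true) ≟ᶠ v)) Data.Nat.+
  indicator (does (src G (e , false) ≟ᶠ v)))

data Walk (G : Graph) : Node G → Node G → Set where
  [] : ∀ {u} → Walk G u u
  _∷_ : ∀ {u} (e : OEdge G) → Walk G (tgt G e) u → Walk G (src G e) u

Connected : Graph → Set
Connected G = (u v : Node G) → Walk G u v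

Chain : (G : Graph) → List (OEdge G) → Set
Chain G []            = ⊤
Chain G (e ∷ [])      = ⊤
Chain G (e ∷ f ∷ es)  = (tgt G e ≡ src G f) × Chain G (f ∷ es)

lastOE : (G : Graph) → OEdge G → List (OEdge G) → OEdge G
lastOE G e []       = e
lastOE G e (f ∷ es) = lastOE G f es

-- A cycle: a nonempty closed walk e₀ … e_{k-1} (k ≥ 1) with t(e_i) = s(e_{i+1})
-- and t(e_{k-1}) = s(e₀), using pairwise distinct edges and passing through
-- pairwise distinct nodes. (Loops are cycles of length 1; two parallel edges
-- form a cycle of length 2.)
record Cycle (G : Graph) : Set where
  field
    first : OEdge G
    rest  : List (OEdge G)
    chain : Chain G (first ∷ rest)
    closed : tgt G (lastOE G first rest) ≡ src G first
    distinctEdges : Unique (map proj₁ (first ∷ rest))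
    distinctNodes : Unique (map (src G) (first ∷ rest))

_∈E_ : {G : Graph} → Edge G → Cycle G → Set
_∈E_ {G} e c = e ∈ map proj₁ (Cycle.first c ∷ Cycle.rest c)

AtLeastTwoCycles : Graph → Set
AtLeastTwoCycles G = Σ (Cycle G) λ c₁ → Σ (Cycle G) λ c₂ →
  ¬ (∀ e → (_∈E_ {G} e c₁) ⇔ (_∈E_ {G} e c₂))

_≟ₒ_ : {G : Graph} → (f e : OEdge G) → Dec (f ≡ e)
_≟ₒ_ = ≡-dec _≟ᶠ_ _≟ᵇ_

B : (G : Graph) → OEdge G → OEdge G → ℚ
B G f e = if does (tgt G e ≟ᶠ src G f) ∧ not (does (_≟ₒ_ {G} f (rev G e)))
          then 1ℚ else 0ℚ

Vector : Graph → Set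
Vector G = OEdge G → ℚ

InKer : (G : Graph) → Vector G → Set
InKer G x = ∀ f → ΣOE G (λ e → B G f e * x e) ≡ x f

lincomb : (G : Graph) (d : ℕ) → (Fin d → ℚ) → (Fin d → Vector G) → Vector G
lincomb G d c v f = ΣFin d (λ i → c i * v i f)

LinIndep : (G : Graph) (d : ℕ) → (Fin d → Vector G) → Set
LinIndep G d v = ∀ (c : Fin d → ℚ) → (∀ f → lincomb G d c v f ≡ 0ℚ) → ∀ i → c i ≡ 0ℚ

DimKerBminusI≡ : (G : Graph) → ℕ → Set
DimKerBminusI≡ G d = Σ (Fin d → Vector G) λ b →
  (∀ i → InKer G (b i)) ×
  LinIndep G d b ×
  (∀ x → InKer G x → Σ (Fin d → ℚ) λ c → ∀ f → lincomb G d c b f ≡ x f)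

module Submission where

-- Write inflow x v for the sum of x over the oriented edges entering v. Since
-- (B x) f = inflow x (s f) - x f̄, a vector x lies in ker(B - I) iff
-- x f + x f̄ = inflow x (s f) for every f. Then inflow x is constant along edges, hence
-- equal to one constant C on the connected graph, and summing over the nodes, resp. over
-- the oriented edges, gives n C = m C. When n ≠ m this forces C = 0, so x is antisymmetric
-- and satisfies Kirchhoff's law: ker(B - I) is the cycle space, which has dimension
-- m - n + 1 (induction on n, contracting a non-loop edge). Finally n ≠ m, for otherwise the
-- cycle space would be one-dimensional, whereas the signed indicator vectors of two cycles
-- with different edge sets are not proportional.

open import Data.Bool using (true; false; not; if_then_else_; _∧_)
open import Data.Bool.Properties using (∧-identityʳ; ∧-zeroʳ; not-involutive)
open import Data.Empty using (⊥-elim)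
open import Data.Fin using (Fin; zero; suc; punchIn; punchOut; _≟_)
open import Data.Fin.Properties using (punchIn-punchOut; punchOut-punchIn; punchOut-cong; punchInᵢ≢i)
open import Data.List using (List; []; _∷_; map)
open import Data.List.Membership.Propositional using (_∈_)
open import Data.List.Relation.Unary.All.Properties using (All¬⇒¬Any)
open import Data.List.Relation.Unary.AllPairs using (_∷_)
open import Data.List.Relation.Unary.Any using (here; there; any?)
open import Data.List.Relation.Unary.Unique.Propositional using (Unique)
open import Data.Nat as ℕ using (ℕ; zero; suc)
open import Data.Nat.Properties using (+-suc; +-comm; +-cancelʳ-≡)
open import Data.Product using (Σ; _×_; _,_; proj₁; proj₂)
open import Data.Vec.Functional using (removeAt; insertAt)
open import Data.Vec.Functional.Properties
  using (removeAt-punchOut; removeAt-insertAt; insertAt-lookup; insertAt-punchIn)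
open import Function using (_∘_; mk⇔)
open import Relation.Binary.PropositionalEquality
open import Relation.Nullary using (Dec; yes; no; does; ¬_)

open import Defs

-- The operators of ℚ are opened only inside this module: the statement at the end uses ℕ's _+_.
module _ where

  open import Data.Rational using (ℚ; 0ℚ; 1ℚ; _+_; _*_; _-_; -_; _<_)
  import Data.Rational.Properties as ℚ
  open import Data.Rational.Solver using (module +-*-Solver)
  open import Algebra.Apartness.Properties.HeytingCommutativeRing ℚ.heytingCommutativeRing
    using (x#0y#0→xy#0)
  open import Algebra.Properties.Group ℚ.+-0-group
    using (∙-cancelˡ; x∙y⁻¹≈ε⇒x≈y; inverseʳ-unique; ⁻¹-involutive)
  open +-*-Solver
  open ≡-Reasoning

  δ : ∀ {k} → Fin k → Fin k → ℚ
  δ i j = if does (i ≟ j) then 1ℚ else 0ℚ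

  δ-refl : ∀ {k} (i : Fin k) → δ i i ≡ 1ℚ
  δ-refl i with i ≟ i
  ... | yes _   = refl
  ... | no  i≢i = ⊥-elim (i≢i refl)

  δ-≢ : ∀ {k} {i j : Fin k} → i ≢ j → δ i j ≡ 0ℚ
  δ-≢ {i = i} {j} i≢j with i ≟ j
  ... | yes i≡j = ⊥-elim (i≢j i≡j)
  ... | no  _   = refl

  δ-sym : ∀ {k} (i j : Fin k) → δ i j ≡ δ j i
  δ-sym i j with i ≟ j | j ≟ i
  ... | yes _   | yes _   = refl
  ... | no  _   | no  _   = refl
  ... | yes i≡j | no  j≢i = ⊥-elim (j≢i (sym i≡j))
  ... | no  i≢j | yes j≡i = ⊥-elim (i≢j (sym j≡i))

  ΣFin-cong : ∀ k {f g : Fin k → ℚ} → (∀ i → f i ≡ g i) → ΣFin k f ≡ ΣFin k g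
  ΣFin-cong zero    f≗g = refl
  ΣFin-cong (suc k) f≗g = cong₂ _+_ (f≗g zero) (ΣFin-cong k (f≗g ∘ suc))

  ΣFin-0 : ∀ k → ΣFin k (λ _ → 0ℚ) ≡ 0ℚ
  ΣFin-0 zero    = refl
  ΣFin-0 (suc k) = cong (0ℚ +_) (ΣFin-0 k)

  ΣFin-≡0 : ∀ k {f : Fin k → ℚ} → (∀ i → f i ≡ 0ℚ) → ΣFin k f ≡ 0ℚ
  ΣFin-≡0 k f≡0 = trans (ΣFin-cong k f≡0) (ΣFin-0 k)

  ΣFin-+ : ∀ k (f g : Fin k → ℚ) → ΣFin k (λ i → f i + g i) ≡ ΣFin k f + ΣFin k g
  ΣFin-+ zero    f g = refl
  ΣFin-+ (suc k) f g = begin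
    (f zero + g zero) + ΣFin k (λ i → f (suc i) + g (suc i))
      ≡⟨ cong ((f zero + g zero) +_) (ΣFin-+ k (f ∘ suc) (g ∘ suc)) ⟩
    (f zero + g zero) + (ΣFin k (f ∘ suc) + ΣFin k (g ∘ suc))
      ≡⟨ solve 4 (λ a b c d → (a :+ b) :+ (c :+ d) := (a :+ c) :+ (b :+ d)) refl
           (f zero) (g zero) (ΣFin k (f ∘ suc)) (ΣFin k (g ∘ suc)) ⟩
    ΣFin (suc k) f + ΣFin (suc k) g ∎

  ΣFin-*ˡ : ∀ k c (f : Fin k → ℚ) → ΣFin k (λ i → c * f i) ≡ c * ΣFin k f
  ΣFin-*ˡ zero    c f = sym (ℚ.*-zeroʳ c)
  ΣFin-*ˡ (suc k) c f =
    trans (cong (c * f zero +_) (ΣFin-*ˡ k c (f ∘ suc))) (sym (ℚ.*-distribˡ-+ c (f zero) _))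

  ΣFin-neg : ∀ k (f : Fin k → ℚ) → ΣFin k (λ i → - f i) ≡ - ΣFin k f
  ΣFin-neg zero    f = refl
  ΣFin-neg (suc k) f =
    trans (cong (- f zero +_) (ΣFin-neg k (f ∘ suc))) (sym (ℚ.neg-distrib-+ (f zero) _))

  ΣFin-- : ∀ k (f g : Fin k → ℚ) → ΣFin k (λ i → f i - g i) ≡ ΣFin k f - ΣFin k g
  ΣFin-- k f g = trans (ΣFin-+ k f (λ i → - g i)) (cong (ΣFin k f +_) (ΣFin-neg k g))

  ΣFin-swap : ∀ k l (f : Fin k → Fin l → ℚ) →
    ΣFin k (λ i → ΣFin l (f i)) ≡ ΣFin l (λ j → ΣFin k (λ i → f i j))
  ΣFin-swap zero    l f = sym (ΣFin-0 l)
  ΣFin-swap (suc k) l f =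
    trans (cong (ΣFin l (f zero) +_) (ΣFin-swap k l (f ∘ suc)))
          (sym (ΣFin-+ l (f zero) (λ j → ΣFin k (λ i → f (suc i) j))))

  ΣFin-punchIn : ∀ k (p : Fin (suc k)) (f : Fin (suc k) → ℚ) →
    ΣFin (suc k) f ≡ f p + ΣFin k (removeAt f p)
  ΣFin-punchIn k       zero    f = refl
  ΣFin-punchIn (suc k) (suc p) f =
    trans (cong (f zero +_) (ΣFin-punchIn k p (f ∘ suc)))
          (solve 3 (λ a b c → a :+ (b :+ c) := b :+ (a :+ c)) refl
            (f zero) (f (suc p)) (ΣFin k (removeAt (f ∘ suc) p)))

  ΣFin-single : ∀ k (j : Fin k) (f : Fin k → ℚ) → (∀ i → i ≢ j → f i ≡ 0ℚ) → ΣFin k f ≡ f j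
  ΣFin-single (suc k) j f f≡0 = begin
    ΣFin (suc k) f              ≡⟨ ΣFin-punchIn k j f ⟩
    f j + ΣFin k (removeAt f j) ≡⟨ cong (f j +_) (ΣFin-≡0 k (λ i → f≡0 _ (punchInᵢ≢i j i))) ⟩
    f j + 0ℚ                    ≡⟨ ℚ.+-identityʳ (f j) ⟩
    f j ∎

  ΣFin-δ : ∀ k (j : Fin k) (f : Fin k → ℚ) → ΣFin k (λ i → f i * δ i j) ≡ f j
  ΣFin-δ k j f = begin
    ΣFin k (λ i → f i * δ i j)
      ≡⟨ ΣFin-single k j _ (λ i i≢j → trans (cong (f i *_) (δ-≢ i≢j)) (ℚ.*-zeroʳ (f i))) ⟩
    f j * δ j j  ≡⟨ cong (f j *_) (δ-refl j) ⟩
    f j * 1ℚ     ≡⟨ ℚ.*-identityʳ (f j) ⟩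
    f j ∎

  ΣFin-δ-const : ∀ k (j : Fin k) c → ΣFin k (λ i → δ j i * c) ≡ c
  ΣFin-δ-const k j c = begin
    ΣFin k (λ i → δ j i * c)
      ≡⟨ ΣFin-single k j _ (λ i i≢j → trans (cong (_* c) (δ-≢ (i≢j ∘ sym))) (ℚ.*-zeroˡ c)) ⟩
    δ j j * c  ≡⟨ cong (_* c) (δ-refl j) ⟩
    1ℚ * c     ≡⟨ ℚ.*-identityˡ c ⟩
    c ∎

  combination : {A : Set} (d : ℕ) → (Fin d → ℚ) → (Fin d → A → ℚ) → A → ℚ
  combination d c b a = ΣFin d (λ i → c i * b i a)

  ΣFin-combination : ∀ k d (w : Fin k → ℚ) c (b : Fin d → Fin k → ℚ) →
    ΣFin k (λ a → w a * combination d c b a) ≡ ΣFin d (λ i → c i * ΣFin k (λ a → w a * b i a))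
  ΣFin-combination k d w c b = begin
    ΣFin k (λ a → w a * ΣFin d (λ i → c i * b i a))
      ≡⟨ ΣFin-cong k (λ a → sym (ΣFin-*ˡ d (w a) _)) ⟩
    ΣFin k (λ a → ΣFin d (λ i → w a * (c i * b i a)))
      ≡⟨ ΣFin-swap k d _ ⟩
    ΣFin d (λ i → ΣFin k (λ a → w a * (c i * b i a)))
      ≡⟨ ΣFin-cong d (λ i → ΣFin-cong k (λ a →
           solve 3 (λ w c b → w :* (c :* b) := c :* (w :* b)) refl (w a) (c i) (b i a))) ⟩
    ΣFin d (λ i → ΣFin k (λ a → c i * (w a * b i a)))
      ≡⟨ ΣFin-cong d (λ i → ΣFin-*ˡ k (c i) _) ⟩
    ΣFin d (λ i → c i * ΣFin k (λ a → w a * b i a)) ∎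

  x*y≡0⇒y≢0⇒x≡0 : ∀ {x y} → x * y ≡ 0ℚ → y ≢ 0ℚ → x ≡ 0ℚ
  x*y≡0⇒y≢0⇒x≡0 {x} xy≡0 y≢0 with x ℚ.≟ 0ℚ
  ... | yes x≡0 = x≡0
  ... | no  x≢0 = ⊥-elim (x#0y#0→xy#0 x≢0 y≢0 xy≡0)

  ΣFin-const : ∀ k c → ΣFin k (λ _ → c) ≡ c * ΣFin k (λ _ → 1ℚ)
  ΣFin-const k c = trans (ΣFin-cong k (λ _ → sym (ℚ.*-identityʳ c))) (ΣFin-*ˡ k c _)

  ΣFin-1-positive : ∀ k → 0ℚ < ΣFin (suc k) (λ _ → 1ℚ)
  ΣFin-1-positive zero    = ℚ.positive⁻¹ 1ℚ
  ΣFin-1-positive (suc k) = ℚ.+-mono-<-≤ (ℚ.positive⁻¹ 1ℚ) (ℚ.<⇒≤ (ΣFin-1-positive k))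

  ΣFin-const-injective : ∀ k l c → k ≢ l → ΣFin k (λ _ → c) ≡ ΣFin l (λ _ → c) → c ≡ 0ℚ
  ΣFin-const-injective zero    zero    c 0≢0 _  = ⊥-elim (0≢0 refl)
  ΣFin-const-injective zero    (suc l) c _   eq =
    x*y≡0⇒y≢0⇒x≡0 (trans (sym (ΣFin-const (suc l) c)) (sym eq)) (≢-sym (ℚ.<⇒≢ (ΣFin-1-positive l)))
  ΣFin-const-injective (suc k) zero    c k≢l eq =
    ΣFin-const-injective zero (suc k) c (≢-sym k≢l) (sym eq)
  ΣFin-const-injective (suc k) (suc l) c k≢l eq =
    ΣFin-const-injective k l c (k≢l ∘ cong suc) (∙-cancelˡ c _ _ eq)

  HasBasis : {A : Set} → ((A → ℚ) → Set) → ℕ → Set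
  HasBasis {A} P d = Σ (Fin d → A → ℚ) λ b →
    (∀ i → P (b i)) ×
    (∀ c → (∀ a → combination d c b a ≡ 0ℚ) → ∀ i → c i ≡ 0ℚ) ×
    (∀ x → P x → Σ (Fin d → ℚ) λ c → ∀ a → combination d c b a ≡ x a)

  standardBasis : ∀ k (P : (Fin k → ℚ) → Set) → (∀ y → P y) → HasBasis P k
  standardBasis k P all = δ , all ∘ δ , independent , spanning
    where
    independent : ∀ c → (∀ j → combination k c δ j ≡ 0ℚ) → ∀ j → c j ≡ 0ℚ
    independent c comb≡0 j = trans (sym (ΣFin-δ k j c)) (comb≡0 j)
    spanning : ∀ y → P y → Σ (Fin k → ℚ) λ c → ∀ j → combination k c δ j ≡ y j
    spanning y _ = y , λ j → ΣFin-δ k j y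

  record IsRestrictionIso {A A′ : Set} (ι : A′ → A) (P : (A → ℚ) → Set) (P′ : (A′ → ℚ) → Set)
    : Set where
    field
      closed    : ∀ d c b → (∀ i → P (b i)) → P (combination d c b)
      restrict  : ∀ x → P x → P′ (x ∘ ι)
      injective : ∀ x z → P x → P z → (∀ a → x (ι a) ≡ z (ι a)) → ∀ a → x a ≡ z a
      extend    : (A′ → ℚ) → A → ℚ
      extend-∈  : ∀ y → P′ y → P (extend y)
      extend-ι  : ∀ y a → extend y (ι a) ≡ y a

  transferBasis : ∀ {A A′ : Set} {ι : A′ → A} {P P′} {d} →
    IsRestrictionIso ι P P′ → HasBasis P′ d → HasBasis P d
  transferBasis {ι = ι} {P} {d = d} iso (b , b∈P′ , independent , spanning) =
    extend ∘ b , b∈P , independent′ , spanning′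
    where
    open IsRestrictionIso iso
    b∈P : ∀ i → P (extend (b i))
    b∈P i = extend-∈ (b i) (b∈P′ i)
    combination-ι : ∀ c a → combination d c (extend ∘ b) (ι a) ≡ combination d c b a
    combination-ι c a = ΣFin-cong d (λ i → cong (c i *_) (extend-ι (b i) a))
    independent′ : ∀ c → (∀ a → combination d c (extend ∘ b) a ≡ 0ℚ) → ∀ i → c i ≡ 0ℚ
    independent′ c comb≡0 = independent c (λ a → trans (sym (combination-ι c a)) (comb≡0 (ι a)))
    spanning′ : ∀ x → P x → Σ (Fin d → ℚ) λ c → ∀ a → combination d c (extend ∘ b) a ≡ x a
    spanning′ x x∈P = c , injective _ x (closed d c _ b∈P) x∈P (λ a → trans (combination-ι c a) (comb≡x a))
      where
      c = proj₁ (spanning (x ∘ ι) (restrict x x∈P))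
      comb≡x = proj₂ (spanning (x ∘ ι) (restrict x x∈P))

  supportInDimension1 : ∀ {A : Set} {P : (A → ℚ) → Set} → HasBasis P 1 →
    ∀ {x y} → P x → P y → ∀ {a₀} → y a₀ ≢ 0ℚ → ∀ a → x a ≢ 0ℚ → y a ≢ 0ℚ
  supportInDimension1 (b , _ , _ , spanning) {x} {y} x∈P y∈P {a₀} ya₀≢0 a xa≢0 =
    subst (_≢ 0ℚ) (y≡βb a) (x#0y#0→xy#0 β≢0 ba≢0)
    where
    α = proj₁ (spanning x x∈P) zero
    β = proj₁ (spanning y y∈P) zero
    x≡αb : ∀ a → α * b zero a ≡ x a
    x≡αb a = trans (sym (ℚ.+-identityʳ _)) (proj₂ (spanning x x∈P) a)
    y≡βb : ∀ a → β * b zero a ≡ y a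
    y≡βb a = trans (sym (ℚ.+-identityʳ _)) (proj₂ (spanning y y∈P) a)
    β≢0 : β ≢ 0ℚ
    β≢0 β≡0 = ya₀≢0 (trans (sym (y≡βb a₀)) (trans (cong (_* b zero a₀) β≡0) (ℚ.*-zeroˡ (b zero a₀))))
    ba≢0 : b zero a ≢ 0ℚ
    ba≢0 ba≡0 = xa≢0 (trans (sym (x≡αb a)) (trans (cong (α *_) ba≡0) (ℚ.*-zeroʳ α)))

  coboundary : (G : Graph) → (Node G → ℚ) → Edge G → ℚ
  coboundary G h e = h (proj₂ (ends G e)) - h (proj₁ (ends G e))

  pairing : (G : Graph) → (Edge G → ℚ) → (Node G → ℚ) → ℚ
  pairing G y h = ΣFin (m G) (λ e → coboundary G h e * y e)

  -- Flows are defined as the annihilator of the coboundaries; taking h = δ v gives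
  -- Kirchhoff's law at v, and conversely.
  IsFlow : (G : Graph) → (Edge G → ℚ) → Set
  IsFlow G y = ∀ h → pairing G y h ≡ 0ℚ

  pairing-cong : ∀ G h {y z} → (∀ e → y e ≡ z e) → pairing G y h ≡ pairing G z h
  pairing-cong G h y≗z = ΣFin-cong (m G) (λ e → cong (coboundary G h e *_) (y≗z e))

  pairing-congʰ : ∀ G y {h h′} → (∀ v → h v ≡ h′ v) → pairing G y h ≡ pairing G y h′
  pairing-congʰ G y h≗h′ = ΣFin-cong (m G) (λ e → cong (_* y e) (cong₂ _-_ (h≗h′ _) (h≗h′ _)))

  pairing-0 : ∀ G h → pairing G (λ _ → 0ℚ) h ≡ 0ℚ
  pairing-0 G h = ΣFin-≡0 (m G) (λ e → ℚ.*-zeroʳ (coboundary G h e))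

  pairing-+ : ∀ G y z h → pairing G (λ e → y e + z e) h ≡ pairing G y h + pairing G z h
  pairing-+ G y z h =
    trans (ΣFin-cong (m G) (λ e → ℚ.*-distribˡ-+ (coboundary G h e) (y e) (z e))) (ΣFin-+ (m G) _ _)

  pairing-linearʰ : ∀ G y h₁ h₂ μ →
    pairing G y (λ v → h₁ v + μ * h₂ v) ≡ pairing G y h₁ + μ * pairing G y h₂
  pairing-linearʰ G y h₁ h₂ μ = begin
    pairing G y (λ v → h₁ v + μ * h₂ v)
      ≡⟨ ΣFin-cong (m G) (λ e → solve 6 (λ t₁ s₁ t₂ s₂ μ y →
           ((t₁ :+ μ :* t₂) :- (s₁ :+ μ :* s₂)) :* y := (t₁ :- s₁) :* y :+ μ :* ((t₂ :- s₂) :* y)) refl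
           (h₁ (proj₂ (ends G e))) (h₁ (proj₁ (ends G e))) (h₂ (proj₂ (ends G e))) (h₂ (proj₁ (ends G e)))
           μ (y e)) ⟩
    ΣFin (m G) (λ e → coboundary G h₁ e * y e + μ * (coboundary G h₂ e * y e))
      ≡⟨ ΣFin-+ (m G) _ _ ⟩
    pairing G y h₁ + ΣFin (m G) (λ e → μ * (coboundary G h₂ e * y e))
      ≡⟨ cong (pairing G y h₁ +_) (ΣFin-*ˡ (m G) μ _) ⟩
    pairing G y h₁ + μ * pairing G y h₂ ∎

  flow-combination : ∀ G d c b → (∀ i → IsFlow G (b i)) → IsFlow G (combination d c b)
  flow-combination G d c b flows h = begin
    pairing G (combination d c b) h
      ≡⟨ ΣFin-combination (m G) d (coboundary G h) c b ⟩
    ΣFin d (λ i → c i * pairing G (b i) h)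
      ≡⟨ ΣFin-≡0 d (λ i → trans (cong (c i *_) (flows i h)) (ℚ.*-zeroʳ (c i))) ⟩
    0ℚ ∎

  coboundary-expand : ∀ G h e → coboundary G h e ≡ combination (n G) h (λ v → coboundary G (δ v)) e
  coboundary-expand G h e = sym (begin
    ΣFin (n G) (λ v → h v * (δ v t - δ v s))
      ≡⟨ ΣFin-cong (n G) (λ v →
           solve 3 (λ h x y → h :* (x :- y) := h :* x :- h :* y) refl (h v) (δ v t) (δ v s)) ⟩
    ΣFin (n G) (λ v → h v * δ v t - h v * δ v s)
      ≡⟨ ΣFin-- (n G) _ _ ⟩
    ΣFin (n G) (λ v → h v * δ v t) - ΣFin (n G) (λ v → h v * δ v s)
      ≡⟨ cong₂ _-_ (ΣFin-δ (n G) t h) (ΣFin-δ (n G) s h) ⟩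
    h t - h s ∎)
    where
    s = proj₁ (ends G e)
    t = proj₂ (ends G e)

  pairing-expand : ∀ G y h → pairing G y h ≡ ΣFin (n G) (λ v → h v * pairing G y (δ v))
  pairing-expand G y h = begin
    ΣFin (m G) (λ e → coboundary G h e * y e)
      ≡⟨ ΣFin-cong (m G) (λ e → trans (ℚ.*-comm _ (y e)) (cong (y e *_) (coboundary-expand G h e))) ⟩
    ΣFin (m G) (λ e → y e * combination (n G) h (λ v → coboundary G (δ v)) e)
      ≡⟨ ΣFin-combination (m G) (n G) y h (λ v → coboundary G (δ v)) ⟩
    ΣFin (n G) (λ v → h v * ΣFin (m G) (λ e → y e * coboundary G (δ v) e))
      ≡⟨ ΣFin-cong (n G) (λ v → cong (h v *_) (ΣFin-cong (m G) (λ e → ℚ.*-comm (y e) _))) ⟩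
    ΣFin (n G) (λ v → h v * pairing G y (δ v)) ∎

  kirchhoff⇒flow : ∀ G y → (∀ v → pairing G y (δ v) ≡ 0ℚ) → IsFlow G y
  kirchhoff⇒flow G y kirchhoff h = begin
    pairing G y h
      ≡⟨ pairing-expand G y h ⟩
    ΣFin (n G) (λ v → h v * pairing G y (δ v))
      ≡⟨ ΣFin-≡0 (n G) (λ v → trans (cong (h v *_) (kirchhoff v)) (ℚ.*-zeroʳ (h v))) ⟩
    0ℚ ∎

  _++ᵂ_ : ∀ {G u v w} → Walk G u v → Walk G v w → Walk G u w
  []      ++ᵂ q = q
  (f ∷ p) ++ᵂ q = f ∷ (p ++ᵂ q)

  nonLoopEdge : ∀ G {u v} → Walk G u v → u ≢ v → Σ (Edge G) λ e → proj₁ (ends G e) ≢ proj₂ (ends G e)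
  nonLoopEdge G []      u≢u = ⊥-elim (u≢u refl)
  nonLoopEdge G (f ∷ p) u≢v with src G f ≟ tgt G f
  ... | yes s≡t = nonLoopEdge G p (u≢v ∘ trans s≡t)
  ... | no  s≢t = proj₁ f , ends-≢ f s≢t
    where
    ends-≢ : ∀ f → src G f ≢ tgt G f → proj₁ (ends G (proj₁ f)) ≢ proj₂ (ends G (proj₁ f))
    ends-≢ (e , true)  s≢t = s≢t
    ends-≢ (e , false) s≢t = s≢t ∘ sym

  ≗-by-removeAt : ∀ {A : Set} {k} (f g : Fin (suc k) → A) (p : Fin (suc k)) →
    f p ≡ g p → (∀ i → removeAt f p i ≡ removeAt g p i) → ∀ i → f i ≡ g i
  ≗-by-removeAt f g p fp≡gp rest i with p ≟ i
  ... | yes refl = fp≡gp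
  ... | no  p≢i  = begin
    f i                         ≡⟨ removeAt-punchOut f p≢i ⟨
    removeAt f p (punchOut p≢i) ≡⟨ rest (punchOut p≢i) ⟩
    removeAt g p (punchOut p≢i) ≡⟨ removeAt-punchOut g p≢i ⟩
    g i ∎

  graph : (n m : ℕ) → (Fin m → Fin n × Fin n) → Graph
  graph n m ends = record { n = n ; m = m ; ends = ends }

  -- Contraction of the non-loop edge e₀ = ab: b is merged into a.
  module Contraction {k m} (ends : Fin (suc m) → Fin (suc (suc k)) × Fin (suc (suc k)))
    (e₀ : Fin (suc m)) (a≢b : proj₁ (ends e₀) ≢ proj₂ (ends e₀)) where

    G : Graph
    G = graph (suc (suc k)) (suc m) ends

    a b : Fin (suc (suc k))
    a = proj₁ (ends e₀)
    b = proj₂ (ends e₀)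

    merge : Fin (suc (suc k)) → Fin (suc k)
    merge v with b ≟ v
    ... | yes _   = punchOut (a≢b ∘ sym)
    ... | no  b≢v = punchOut b≢v

    merge-punchIn : ∀ w → merge (punchIn b w) ≡ w
    merge-punchIn w with b ≟ punchIn b w
    ... | yes b≡w = ⊥-elim (punchInᵢ≢i b w (sym b≡w))
    ... | no  b≢w = trans (punchOut-cong b refl) (punchOut-punchIn b)

    punchIn-merge-b : punchIn b (merge b) ≡ a
    punchIn-merge-b with b ≟ b
    ... | yes _   = punchIn-punchOut (a≢b ∘ sym)
    ... | no  b≢b = ⊥-elim (b≢b refl)

    punchIn-merge : ∀ {v} → b ≢ v → punchIn b (merge v) ≡ v
    punchIn-merge {v} b≢v with b ≟ v
    ... | yes b≡v = ⊥-elim (b≢v b≡v)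
    ... | no  b≢v = punchIn-punchOut b≢v

    merge-a≡merge-b : merge a ≡ merge b
    merge-a≡merge-b = trans (cong merge (sym punchIn-merge-b)) (merge-punchIn (merge b))

    contractedEnds : Fin m → Fin (suc k) × Fin (suc k)
    contractedEnds e = merge (proj₁ (ends (punchIn e₀ e))) , merge (proj₂ (ends (punchIn e₀ e)))

    G′ : Graph
    G′ = graph (suc k) m contractedEnds

    mergeEdge : ∀ f → Walk G′ (merge (src G f)) (merge (tgt G f))
    mergeEdge (e , o) with e₀ ≟ e
    ... | yes refl = collapsed o
      where
      collapsed : ∀ o → Walk G′ (merge (src G (e₀ , o))) (merge (tgt G (e₀ , o)))
      collapsed true  = subst (Walk G′ (merge a)) merge-a≡merge-b []
      collapsed false = subst (Walk G′ (merge b)) (sym merge-a≡merge-b) []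
    ... | no e₀≢e = subst (λ e → Walk G′ (merge (src G (e , o))) (merge (tgt G (e , o))))
                          (punchIn-punchOut e₀≢e) (kept (punchOut e₀≢e) o)
      where
      kept : ∀ e′ o → Walk G′ (merge (src G (punchIn e₀ e′ , o))) (merge (tgt G (punchIn e₀ e′ , o)))
      kept e′ true  = (e′ , true) ∷ []
      kept e′ false = (e′ , false) ∷ []

    mergeWalk : ∀ {u v} → Walk G u v → Walk G′ (merge u) (merge v)
    mergeWalk []      = []
    mergeWalk (f ∷ p) = mergeEdge f ++ᵂ mergeWalk p

    connected : Connected G → Connected G′
    connected conn u v = subst₂ (Walk G′) (merge-punchIn u) (merge-punchIn v)
      (mergeWalk (conn (punchIn b u) (punchIn b v)))

    pairing-e₀ : ∀ y h → pairing G y h ≡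
      coboundary G h e₀ * y e₀ + ΣFin m (λ e → coboundary G h (punchIn e₀ e) * y (punchIn e₀ e))
    pairing-e₀ y h = ΣFin-punchIn m e₀ (λ e → coboundary G h e * y e)

    pairing-merge : ∀ y h′ → pairing G y (h′ ∘ merge) ≡ pairing G′ (removeAt y e₀) h′
    pairing-merge y h′ = begin
      pairing G y (h′ ∘ merge)
        ≡⟨ pairing-e₀ y (h′ ∘ merge) ⟩
      (h′ (merge b) - h′ (merge a)) * y e₀ + pairing G′ (removeAt y e₀) h′
        ≡⟨ cong (λ c → c * y e₀ + pairing G′ (removeAt y e₀) h′)
             (trans (cong (λ v → h′ (merge b) - h′ v) merge-a≡merge-b) (ℚ.+-inverseʳ (h′ (merge b)))) ⟩
      0ℚ * y e₀ + pairing G′ (removeAt y e₀) h′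
        ≡⟨ cong (_+ pairing G′ (removeAt y e₀) h′) (ℚ.*-zeroˡ (y e₀)) ⟩
      0ℚ + pairing G′ (removeAt y e₀) h′
        ≡⟨ ℚ.+-identityˡ _ ⟩
      pairing G′ (removeAt y e₀) h′ ∎

    restrict : ∀ y → IsFlow G y → IsFlow G′ (removeAt y e₀)
    restrict y flow h′ = trans (sym (pairing-merge y h′)) (flow (h′ ∘ merge))

    -- Kirchhoff's law at b, solved for the value on e₀.
    balance : (Fin m → ℚ) → ℚ
    balance y′ = - ΣFin m (λ e → coboundary G (δ b) (punchIn e₀ e) * y′ e)

    balance-cong : ∀ {y z} → (∀ e → y e ≡ z e) → balance y ≡ balance z
    balance-cong y≗z = cong -_ (ΣFin-cong m (λ e → cong (coboundary G (δ b) (punchIn e₀ e) *_) (y≗z e)))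

    pairing-δb : ∀ y → pairing G y (δ b) ≡ y e₀ - balance (removeAt y e₀)
    pairing-δb y = begin
      pairing G y (δ b)
        ≡⟨ pairing-e₀ y (δ b) ⟩
      (δ b b - δ b a) * y e₀ + r
        ≡⟨ cong (λ c → c * y e₀ + r) (cong₂ _-_ (δ-refl b) (δ-≢ (a≢b ∘ sym))) ⟩
      (1ℚ - 0ℚ) * y e₀ + r
        ≡⟨ solve 2 (λ x r → (con 1ℚ :- con 0ℚ) :* x :+ r := x :- (:- r)) refl (y e₀) r ⟩
      y e₀ - balance (removeAt y e₀) ∎
      where
      r = ΣFin m (λ e → coboundary G (δ b) (punchIn e₀ e) * y (punchIn e₀ e))

    flow-e₀ : ∀ y → IsFlow G y → y e₀ ≡ balance (removeAt y e₀)
    flow-e₀ y flow = x∙y⁻¹≈ε⇒x≈y _ _ (trans (sym (pairing-δb y)) (flow (δ b)))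

    extend : (Fin m → ℚ) → Fin (suc m) → ℚ
    extend y′ = insertAt y′ e₀ (balance y′)

    potential-decomposition : ∀ (h : Fin (suc (suc k)) → ℚ) v →
      h v ≡ h (punchIn b (merge v)) + (h b - h a) * δ b v
    potential-decomposition h v = decompose v (b ≟ v)
      where
      decompose : ∀ v → Dec (b ≡ v) → h v ≡ h (punchIn b (merge v)) + (h b - h a) * δ b v
      decompose .b (yes refl) = begin
        h b
          ≡⟨ solve 2 (λ x y → y := x :+ (y :- x) :* con 1ℚ) refl (h a) (h b) ⟩
        h a + (h b - h a) * 1ℚ
          ≡⟨ cong₂ (λ v c → h v + (h b - h a) * c) (sym punchIn-merge-b) (sym (δ-refl b)) ⟩
        h (punchIn b (merge b)) + (h b - h a) * δ b b ∎
      decompose v (no b≢v) = begin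
        h v
          ≡⟨ solve 2 (λ x μ → x := x :+ μ :* con 0ℚ) refl (h v) (h b - h a) ⟩
        h v + (h b - h a) * 0ℚ
          ≡⟨ cong₂ (λ v c → h v + (h b - h a) * c) (sym (punchIn-merge b≢v)) (sym (δ-≢ b≢v)) ⟩
        h (punchIn b (merge v)) + (h b - h a) * δ b v ∎

    extend-flow : ∀ y′ → IsFlow G′ y′ → IsFlow G (extend y′)
    extend-flow y′ flow h = begin
      pairing G Y h
        ≡⟨ pairing-congʰ G Y (potential-decomposition h) ⟩
      pairing G Y (λ v → h′ (merge v) + μ * δ b v)
        ≡⟨ pairing-linearʰ G Y (h′ ∘ merge) (δ b) μ ⟩
      pairing G Y (h′ ∘ merge) + μ * pairing G Y (δ b)
        ≡⟨ cong₂ (λ p q → p + μ * q) merged balanced ⟩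
      0ℚ + μ * 0ℚ
        ≡⟨ solve 1 (λ μ → con 0ℚ :+ μ :* con 0ℚ := con 0ℚ) refl μ ⟩
      0ℚ ∎
      where
      Y = extend y′
      h′ = h ∘ punchIn b
      μ = h b - h a
      merged : pairing G Y (h′ ∘ merge) ≡ 0ℚ
      merged = trans (pairing-merge Y h′) (trans (pairing-cong G′ h′ (removeAt-insertAt y′ e₀ _)) (flow h′))
      balanced : pairing G Y (δ b) ≡ 0ℚ
      balanced = trans (pairing-δb Y) (trans
        (cong₂ _-_ (insertAt-lookup y′ e₀ _) (balance-cong (removeAt-insertAt y′ e₀ _)))
        (ℚ.+-inverseʳ (balance y′)))

    restrictionIso : IsRestrictionIso (punchIn e₀) (IsFlow G) (IsFlow G′)
    restrictionIso = record
      { closed    = flow-combination G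
      ; restrict  = restrict
      ; injective = λ x z x-flow z-flow x≗z → ≗-by-removeAt x z e₀
          (trans (flow-e₀ x x-flow) (trans (balance-cong x≗z) (sym (flow-e₀ z z-flow)))) x≗z
      ; extend    = extend
      ; extend-∈  = extend-flow
      ; extend-ι  = λ y′ → insertAt-punchIn y′ e₀ (balance y′)
      }

  one-node-coboundary : ∀ (h : Fin 1 → ℚ) (u v : Fin 1) → h u - h v ≡ 0ℚ
  one-node-coboundary h zero zero = ℚ.+-inverseʳ (h zero)

  cycleSpaceDimension : ∀ k m ends → Connected (graph (suc k) m ends) →
    Σ ℕ λ d → (d ℕ.+ suc k ≡ m ℕ.+ 1) × HasBasis (IsFlow (graph (suc k) m ends)) d
  cycleSpaceDimension zero m ends _ = m , refl , standardBasis m _ everyFlow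
    where
    everyFlow : ∀ y → IsFlow (graph 1 m ends) y
    everyFlow y h = ΣFin-≡0 m λ e → trans (cong (_* y e) (one-node-coboundary h _ _)) (ℚ.*-zeroˡ (y e))
  cycleSpaceDimension (suc k) m ends conn
    with nonLoopEdge (graph (suc (suc k)) m ends) (conn zero (suc zero)) (λ ())
  cycleSpaceDimension (suc k) (suc m) ends conn | e₀ , a≢b =
    let open Contraction ends e₀ a≢b
        d , d+n≡m+1 , basis = cycleSpaceDimension k m contractedEnds (connected conn)
    in d , trans (+-suc d (suc k)) (cong suc d+n≡m+1) , transferBasis restrictionIso basis

  cycleSpace : ∀ G → Node G → Connected G →
    Σ ℕ λ d → (d ℕ.+ n G ≡ m G ℕ.+ 1) × HasBasis (IsFlow G) d
  cycleSpace record { n = suc k ; m = m ; ends = ends } _ = cycleSpaceDimension k m ends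

  signedEdge : ∀ G → OEdge G → Edge G → ℚ
  signedEdge G (e′ , true)  e = δ e e′
  signedEdge G (e′ , false) e = - δ e e′

  signedEdge-≢ : ∀ G f {e} → proj₁ f ≢ e → signedEdge G f e ≡ 0ℚ
  signedEdge-≢ G (e′ , true)  e′≢e = δ-≢ (e′≢e ∘ sym)
  signedEdge-≢ G (e′ , false) e′≢e = cong -_ (δ-≢ (e′≢e ∘ sym))

  signedEdge-self : ∀ G f → signedEdge G f (proj₁ f) ≢ 0ℚ
  signedEdge-self G (e , true)  1≡0  = ℚ.1≢0 (trans (sym (δ-refl e)) 1≡0)
  signedEdge-self G (e , false) -1≡0 = ℚ.1≢0 (trans (sym (δ-refl e)) (ℚ.neg-injective -1≡0))

  pairing-signedEdge : ∀ G f h → pairing G (signedEdge G f) h ≡ h (tgt G f) - h (src G f)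
  pairing-signedEdge G (e′ , true)  h = ΣFin-δ (m G) e′ (coboundary G h)
  pairing-signedEdge G (e′ , false) h = begin
    ΣFin (m G) (λ e → coboundary G h e * - δ e e′)
      ≡⟨ ΣFin-cong (m G) (λ e → sym (ℚ.neg-distribʳ-* (coboundary G h e) (δ e e′))) ⟩
    ΣFin (m G) (λ e → - (coboundary G h e * δ e e′))
      ≡⟨ ΣFin-neg (m G) _ ⟩
    - ΣFin (m G) (λ e → coboundary G h e * δ e e′)
      ≡⟨ cong -_ (ΣFin-δ (m G) e′ (coboundary G h)) ⟩
    - (h t - h s)
      ≡⟨ solve 2 (λ s t → :- (t :- s) := s :- t) refl (h s) (h t) ⟩
    h s - h t ∎
    where
    s = proj₁ (ends G e′)
    t = proj₂ (ends G e′)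

  walkVector : ∀ G → List (OEdge G) → Edge G → ℚ
  walkVector G []       e = 0ℚ
  walkVector G (f ∷ fs) e = signedEdge G f e + walkVector G fs e

  pairing-walkVector : ∀ G f fs h → Chain G (f ∷ fs) →
    pairing G (walkVector G (f ∷ fs)) h ≡ h (tgt G (lastOE G f fs)) - h (src G f)
  pairing-walkVector G f [] h _ = begin
    pairing G (walkVector G (f ∷ [])) h
      ≡⟨ pairing-+ G (signedEdge G f) (λ _ → 0ℚ) h ⟩
    pairing G (signedEdge G f) h + pairing G (λ _ → 0ℚ) h
      ≡⟨ cong₂ _+_ (pairing-signedEdge G f h) (pairing-0 G h) ⟩
    (h (tgt G f) - h (src G f)) + 0ℚ
      ≡⟨ ℚ.+-identityʳ _ ⟩
    h (tgt G f) - h (src G f) ∎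
  pairing-walkVector G f (g ∷ gs) h (t≡s , chain) = begin
    pairing G (walkVector G (f ∷ g ∷ gs)) h
      ≡⟨ pairing-+ G (signedEdge G f) (walkVector G (g ∷ gs)) h ⟩
    pairing G (signedEdge G f) h + pairing G (walkVector G (g ∷ gs)) h
      ≡⟨ cong₂ _+_ (pairing-signedEdge G f h) (pairing-walkVector G g gs h chain) ⟩
    (h (tgt G f) - h (src G f)) + (h l - h (src G g))
      ≡⟨ cong (λ v → (h (tgt G f) - h (src G f)) + (h l - h v)) (sym t≡s) ⟩
    (h (tgt G f) - h (src G f)) + (h l - h (tgt G f))
      ≡⟨ solve 3 (λ s t l → (t :- s) :+ (l :- t) := l :- s) refl (h (src G f)) (h (tgt G f)) (h l) ⟩
    h l - h (src G f) ∎
    where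
    l = tgt G (lastOE G g gs)

  walkVector-∉ : ∀ G fs {e} → ¬ e ∈ map proj₁ fs → walkVector G fs e ≡ 0ℚ
  walkVector-∉ G []       _  = refl
  walkVector-∉ G (f ∷ fs) e∉ = trans
    (cong₂ _+_ (signedEdge-≢ G f (e∉ ∘ here ∘ sym)) (walkVector-∉ G fs (e∉ ∘ there)))
    (ℚ.+-identityʳ 0ℚ)

  walkVector-∈ : ∀ G fs {e} → Unique (map proj₁ fs) → e ∈ map proj₁ fs → walkVector G fs e ≢ 0ℚ
  walkVector-∈ G (f ∷ fs) (f∉fs ∷ _) (here refl) = subst (_≢ 0ℚ)
    (sym (trans (cong (signedEdge G f (proj₁ f) +_) (walkVector-∉ G fs (All¬⇒¬Any f∉fs))) (ℚ.+-identityʳ _)))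
    (signedEdge-self G f)
  walkVector-∈ G (f ∷ fs) (f∉fs ∷ unique) (there e∈fs) = subst (_≢ 0ℚ)
    (sym (trans (cong (_+ walkVector G fs _) (signedEdge-≢ G f f≢e)) (ℚ.+-identityˡ _)))
    (walkVector-∈ G fs unique e∈fs)
    where
    f≢e : proj₁ f ≢ _
    f≢e refl = All¬⇒¬Any f∉fs e∈fs

  cycleVector : ∀ {G} → Cycle G → Edge G → ℚ
  cycleVector {G} c = walkVector G (Cycle.first c ∷ Cycle.rest c)

  cycle-flow : ∀ {G} (c : Cycle G) → IsFlow G (cycleVector c)
  cycle-flow {G} c h = begin
    pairing G (cycleVector c) h                       ≡⟨ pairing-walkVector G first rest h chain ⟩
    h (tgt G (lastOE G first rest)) - h (src G first) ≡⟨ cong (λ v → h v - h (src G first)) closed ⟩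
    h (src G first) - h (src G first)                 ≡⟨ ℚ.+-inverseʳ (h (src G first)) ⟩
    0ℚ ∎
    where open Cycle c

  cycleVector-support : ∀ {G} (c : Cycle G) e → _∈E_ {G} e c → cycleVector c e ≢ 0ℚ
  cycleVector-support {G} c e = walkVector-∈ G (Cycle.first c ∷ Cycle.rest c) (Cycle.distinctEdges c)

  cycleVector-support⁻ : ∀ {G} (c : Cycle G) e → cycleVector c e ≢ 0ℚ → _∈E_ {G} e c
  cycleVector-support⁻ {G} c e ≢0 with any? (e ≟_) (map proj₁ (Cycle.first c ∷ Cycle.rest c))
  ... | yes e∈c = e∈c
  ... | no  e∉c = ⊥-elim (≢0 (walkVector-∉ G (Cycle.first c ∷ Cycle.rest c) e∉c))

  twoCycles⇒dim≢1 : ∀ G → AtLeastTwoCycles G → ¬ HasBasis (IsFlow G) 1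
  twoCycles⇒dim≢1 G (c₁ , c₂ , different) basis = different λ e → mk⇔ (included c₁ c₂ e) (included c₂ c₁ e)
    where
    included : ∀ c c′ e → _∈E_ {G} e c → _∈E_ {G} e c′
    included c c′ e e∈c = cycleVector-support⁻ c′ e
      (supportInDimension1 basis (cycle-flow c) (cycle-flow c′)
        (cycleVector-support c′ (proj₁ (Cycle.first c′)) (here refl)) e (cycleVector-support c e e∈c))

  twoCycles⇒n≢m : ∀ G → Connected G → AtLeastTwoCycles G → n G ≢ m G
  twoCycles⇒n≢m G conn cycles@(c₁ , _) n≡m =
    let d , d+n≡m+1 , basis = cycleSpace G (src G (Cycle.first c₁)) conn
    in twoCycles⇒dim≢1 G cycles (subst (HasBasis (IsFlow G)) (d≡1 d+n≡m+1) basis)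
    where
    d≡1 : ∀ {d} → d ℕ.+ n G ≡ m G ℕ.+ 1 → d ≡ 1
    d≡1 {d} d+n≡m+1 =
      +-cancelʳ-≡ (n G) d 1 (trans d+n≡m+1 (trans (cong (ℕ._+ 1) (sym n≡m)) (+-comm (n G) 1)))

  module _ (G : Graph) where

    ΣOE-split : ∀ g → ΣOE G g ≡ ΣFin (m G) (λ e → g (e , true)) + ΣFin (m G) (λ e → g (e , false))
    ΣOE-split g = ΣFin-+ (m G) _ _

    ΣOE-- : ∀ g h → ΣOE G (λ f → g f - h f) ≡ ΣOE G g - ΣOE G h
    ΣOE-- g h = trans
      (ΣFin-cong (m G) (λ e → solve 4 (λ a b c d → (a :- b) :+ (c :- d) := (a :+ c) :- (b :+ d)) refl
        (g (e , true)) (h (e , true)) (g (e , false)) (h (e , false))))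
      (ΣFin-- (m G) _ _)

    ΣOE-single : ∀ (r : OEdge G) g → (∀ f → f ≢ r → g f ≡ 0ℚ) → ΣOE G g ≡ g r
    ΣOE-single (e₀ , o) g g≡0 = trans
      (ΣFin-single (m G) e₀ _ λ e e≢e₀ →
        trans (cong₂ _+_ (g≡0 _ (e≢e₀ ∘ cong proj₁)) (g≡0 _ (e≢e₀ ∘ cong proj₁))) (ℚ.+-identityˡ 0ℚ))
      (other-orientation o g≡0)
      where
      other-orientation : ∀ o → (∀ f → f ≢ (e₀ , o) → g f ≡ 0ℚ) →
        g (e₀ , true) + g (e₀ , false) ≡ g (e₀ , o)
      other-orientation true  g≡0 = trans (cong (g (e₀ , true) +_) (g≡0 _ λ ())) (ℚ.+-identityʳ _)
      other-orientation false g≡0 = trans (cong (_+ g (e₀ , false)) (g≡0 _ λ ())) (ℚ.+-identityˡ _)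

    ΣOE-combination : ∀ d (w : OEdge G → ℚ) c b →
      ΣOE G (λ f → w f * combination d c b f) ≡ ΣFin d (λ i → c i * ΣOE G (λ f → w f * b i f))
    ΣOE-combination d w c b = begin
      ΣOE G (λ f → w f * combination d c b f)
        ≡⟨ ΣOE-split (λ f → w f * combination d c b f) ⟩
      ΣFin (m G) (λ e → w (e , true) * combination d c b (e , true)) +
      ΣFin (m G) (λ e → w (e , false) * combination d c b (e , false))
        ≡⟨ cong₂ _+_ (ΣFin-combination (m G) d (λ e → w (e , true)) c (λ i e → b i (e , true)))
                     (ΣFin-combination (m G) d (λ e → w (e , false)) c (λ i e → b i (e , false))) ⟩
      ΣFin d (λ i → c i * Σ⁺ i) + ΣFin d (λ i → c i * Σ⁻ i)
        ≡⟨ sym (ΣFin-+ d _ _) ⟩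
      ΣFin d (λ i → c i * Σ⁺ i + c i * Σ⁻ i)
        ≡⟨ ΣFin-cong d (λ i → trans (sym (ℚ.*-distribˡ-+ (c i) _ _))
                                    (cong (c i *_) (sym (ΣOE-split (λ f → w f * b i f))))) ⟩
      ΣFin d (λ i → c i * ΣOE G (λ f → w f * b i f)) ∎
      where
      Σ⁺ Σ⁻ : Fin d → ℚ
      Σ⁺ i = ΣFin (m G) (λ e → w (e , true) * b i (e , true))
      Σ⁻ i = ΣFin (m G) (λ e → w (e , false) * b i (e , false))

    rev-involutive : ∀ f → rev G (rev G f) ≡ f
    rev-involutive (e , o) = cong (e ,_) (not-involutive o)

    src-rev : ∀ f → src G (rev G f) ≡ tgt G f
    src-rev (e , true)  = refl
    src-rev (e , false) = refl

    tgt-rev : ∀ f → tgt G (rev G f) ≡ src G f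
    tgt-rev (e , true)  = refl
    tgt-rev (e , false) = refl

    B-≢rev : ∀ f e → e ≢ rev G f → B G f e ≡ δ (tgt G e) (src G f)
    B-≢rev f e e≢f̄ = notBacktracking (_≟ₒ_ {G} f (rev G e))
      where
      notBacktracking : (d : Dec (f ≡ rev G e)) →
        (if does (tgt G e ≟ src G f) ∧ not (does d) then 1ℚ else 0ℚ) ≡ δ (tgt G e) (src G f)
      notBacktracking (yes f≡ē) = ⊥-elim (e≢f̄ (trans (sym (rev-involutive e)) (cong (rev G) (sym f≡ē))))
      notBacktracking (no _)    = cong (if_then 1ℚ else 0ℚ) (∧-identityʳ _)

    B-rev : ∀ f → B G f (rev G f) ≡ 0ℚ
    B-rev f = backtracking (_≟ₒ_ {G} f (rev G (rev G f)))
      where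
      backtracking : (d : Dec (f ≡ rev G (rev G f))) →
        (if does (tgt G (rev G f) ≟ src G f) ∧ not (does d) then 1ℚ else 0ℚ) ≡ 0ℚ
      backtracking (yes _)  = cong (if_then 1ℚ else 0ℚ) (∧-zeroʳ _)
      backtracking (no f≢f) = ⊥-elim (f≢f (sym (rev-involutive f)))

    inflow : Vector G → Node G → ℚ
    inflow x v = ΣOE G (λ f → δ (tgt G f) v * x f)

    B-apply : ∀ x f → ΣOE G (λ e → B G f e * x e) ≡ inflow x (src G f) - x (rev G f)
    B-apply x f = begin
      ΣOE G (λ e → B G f e * x e)
        ≡⟨ ΣFin-cong (m G) (λ e → cong₂ _+_ (split (e , true)) (split (e , false))) ⟩
      ΣOE G (λ e → δ (tgt G e) (src G f) * x e - backtrack e)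
        ≡⟨ ΣOE-- (λ e → δ (tgt G e) (src G f) * x e) backtrack ⟩
      inflow x (src G f) - ΣOE G backtrack
        ≡⟨ cong (λ t → inflow x (src G f) - t) (ΣOE-single (rev G f) backtrack backtrack-≢rev) ⟩
      inflow x (src G f) - backtrack (rev G f)
        ≡⟨ cong (λ t → inflow x (src G f) - t) backtrack-rev ⟩
      inflow x (src G f) - x (rev G f) ∎
      where
      backtrack : OEdge G → ℚ
      backtrack e = (δ (tgt G e) (src G f) - B G f e) * x e
      split : ∀ e → B G f e * x e ≡ δ (tgt G e) (src G f) * x e - backtrack e
      split e = solve 3 (λ β d y → β :* y := d :* y :- (d :- β) :* y) refl
        (B G f e) (δ (tgt G e) (src G f)) (x e)
      backtrack-≢rev : ∀ e → e ≢ rev G f → backtrack e ≡ 0ℚ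
      backtrack-≢rev e e≢f̄ =
        trans (cong (λ β → (δ (tgt G e) (src G f) - β) * x e) (B-≢rev f e e≢f̄))
              (trans (cong (_* x e) (ℚ.+-inverseʳ (δ (tgt G e) (src G f)))) (ℚ.*-zeroˡ (x e)))
      backtrack-rev : backtrack (rev G f) ≡ x (rev G f)
      backtrack-rev = begin
        (δ (tgt G (rev G f)) (src G f) - B G f (rev G f)) * x (rev G f)
          ≡⟨ cong₂ (λ d β → (d - β) * x (rev G f))
               (trans (cong (λ v → δ v (src G f)) (tgt-rev f)) (δ-refl (src G f))) (B-rev f) ⟩
        (1ℚ - 0ℚ) * x (rev G f)
          ≡⟨ ℚ.*-identityˡ (x (rev G f)) ⟩
        x (rev G f) ∎

    inKer-inflow : ∀ x → InKer G x → ∀ f → inflow x (src G f) ≡ x f + x (rev G f)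
    inKer-inflow x ker f = begin
      inflow x (src G f)
        ≡⟨ solve 2 (λ i r → i := (i :- r) :+ r) refl (inflow x (src G f)) (x (rev G f)) ⟩
      (inflow x (src G f) - x (rev G f)) + x (rev G f)
        ≡⟨ cong (_+ x (rev G f)) (trans (sym (B-apply x f)) (ker f)) ⟩
      x f + x (rev G f) ∎

    inKer-inflow-walk : ∀ x → InKer G x → ∀ {u v} → Walk G u v → inflow x u ≡ inflow x v
    inKer-inflow-walk x ker []      = refl
    inKer-inflow-walk x ker (f ∷ p) = trans across (inKer-inflow-walk x ker p)
      where
      across : inflow x (src G f) ≡ inflow x (tgt G f)
      across = begin
        inflow x (src G f)                ≡⟨ inKer-inflow x ker f ⟩
        x f + x (rev G f)                 ≡⟨ ℚ.+-comm (x f) (x (rev G f)) ⟩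
        x (rev G f) + x f                 ≡⟨ cong (λ f′ → x (rev G f) + x f′) (sym (rev-involutive f)) ⟩
        x (rev G f) + x (rev G (rev G f)) ≡⟨ sym (inKer-inflow x ker (rev G f)) ⟩
        inflow x (src G (rev G f))        ≡⟨ cong (inflow x) (src-rev f) ⟩
        inflow x (tgt G f) ∎

    ΣFin-inflow : ∀ x → ΣFin (n G) (inflow x) ≡ ΣOE G x
    ΣFin-inflow x = trans (ΣFin-swap (n G) (m G) _) (ΣFin-cong (m G) λ e →
      let s = proj₁ (ends G e)
          t = proj₂ (ends G e)
      in begin
      ΣFin (n G) (λ v → δ t v * x (e , true) + δ s v * x (e , false))
        ≡⟨ ΣFin-+ (n G) _ _ ⟩
      ΣFin (n G) (λ v → δ t v * x (e , true)) + ΣFin (n G) (λ v → δ s v * x (e , false))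
        ≡⟨ cong₂ _+_ (ΣFin-δ-const (n G) t (x (e , true))) (ΣFin-δ-const (n G) s (x (e , false))) ⟩
      x (e , true) + x (e , false) ∎)

    -- ∑ᵥ inflow x v counts every oriented edge once, so a constant inflow C satisfies n C = m C.
    inKer-inflow≡0 : Connected G → n G ≢ m G → ∀ x → InKer G x → ∀ v → inflow x v ≡ 0ℚ
    inKer-inflow≡0 conn n≢m x ker v = ΣFin-const-injective (n G) (m G) C n≢m (begin
      ΣFin (n G) (λ _ → C)
        ≡⟨ ΣFin-cong (n G) (λ u → sym (constant u)) ⟩
      ΣFin (n G) (inflow x)
        ≡⟨ ΣFin-inflow x ⟩
      ΣOE G x
        ≡⟨ ΣFin-cong (m G) (λ e → sym (inKer-inflow x ker (e , true))) ⟩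
      ΣFin (m G) (λ e → inflow x (src G (e , true)))
        ≡⟨ ΣFin-cong (m G) (λ e → constant _) ⟩
      ΣFin (m G) (λ _ → C) ∎)
      where
      C = inflow x v
      constant : ∀ u → inflow x u ≡ C
      constant u = inKer-inflow-walk x ker (conn u v)

    forward : Vector G → Edge G → ℚ
    forward x e = x (e , true)

    lift : (Edge G → ℚ) → Vector G
    lift y (e , true)  = y e
    lift y (e , false) = - y e

    lift-rev : ∀ y f → lift y (rev G f) ≡ - lift y f
    lift-rev y (e , true)  = refl
    lift-rev y (e , false) = sym (⁻¹-involutive (y e))

    inflow-antisymmetric : ∀ x → (∀ e → x (e , false) ≡ - x (e , true)) →
      ∀ v → inflow x v ≡ pairing G (forward x) (δ v)
    inflow-antisymmetric x antisymmetric v =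
      ΣFin-cong (m G) (λ e → edge (proj₁ (ends G e)) (proj₂ (ends G e)) e)
      where
      edge : ∀ s t e → δ t v * x (e , true) + δ s v * x (e , false) ≡ (δ v t - δ v s) * x (e , true)
      edge s t e = begin
        δ t v * x (e , true) + δ s v * x (e , false)
          ≡⟨ cong₂ (λ p q → p * x (e , true) + δ s v * q) (δ-sym t v) (antisymmetric e) ⟩
        δ v t * x (e , true) + δ s v * - x (e , true)
          ≡⟨ cong (λ p → δ v t * x (e , true) + p * - x (e , true)) (δ-sym s v) ⟩
        δ v t * x (e , true) + δ v s * - x (e , true)
          ≡⟨ solve 3 (λ a b y → a :* y :+ b :* (:- y) := (a :- b) :* y) refl (δ v t) (δ v s) (x (e , true)) ⟩
        (δ v t - δ v s) * x (e , true) ∎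

    flow⇒inKer : ∀ y → IsFlow G y → InKer G (lift y)
    flow⇒inKer y flow f = begin
      ΣOE G (λ e → B G f e * lift y e)
        ≡⟨ B-apply (lift y) f ⟩
      inflow (lift y) (src G f) - lift y (rev G f)
        ≡⟨ cong₂ _-_ (inflow-antisymmetric (lift y) (λ _ → refl) (src G f)) (lift-rev y f) ⟩
      pairing G y (δ (src G f)) - - lift y f
        ≡⟨ cong (λ p → p - - lift y f) (flow (δ (src G f))) ⟩
      0ℚ - - lift y f
        ≡⟨ solve 1 (λ a → con 0ℚ :- (:- a) := a) refl (lift y f) ⟩
      lift y f ∎

    inKer-combination : ∀ d c b → (∀ i → InKer G (b i)) → InKer G (combination d c b)
    inKer-combination d c b ker f = begin
      ΣOE G (λ e → B G f e * combination d c b e)        ≡⟨ ΣOE-combination d (B G f) c b ⟩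
      ΣFin d (λ i → c i * ΣOE G (λ e → B G f e * b i e)) ≡⟨ ΣFin-cong d (λ i → cong (c i *_) (ker i f)) ⟩
      combination d c b f ∎

    kernelRestrictionIso : Connected G → n G ≢ m G → IsRestrictionIso (_, true) (InKer G) (IsFlow G)
    kernelRestrictionIso conn n≢m = record
      { closed    = inKer-combination
      ; restrict  = λ x ker → kirchhoff⇒flow G (forward x) λ v →
          trans (sym (inflow-antisymmetric x (antisymmetric x ker) v)) (inKer-inflow≡0 conn n≢m x ker v)
      ; injective = injective
      ; extend    = lift
      ; extend-∈  = flow⇒inKer
      ; extend-ι  = λ _ _ → refl
      }
      where
      antisymmetric : ∀ x → InKer G x → ∀ e → x (e , false) ≡ - x (e , true)
      antisymmetric x ker e = inverseʳ-unique (x (e , true)) (x (e , false))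
        (trans (sym (inKer-inflow x ker (e , true))) (inKer-inflow≡0 conn n≢m x ker _))
      injective : ∀ x z → InKer G x → InKer G z → (∀ e → x (e , true) ≡ z (e , true)) → ∀ f → x f ≡ z f
      injective x z _     _     x≗z (e , true)  = x≗z e
      injective x z x-ker z-ker x≗z (e , false) =
        trans (antisymmetric x x-ker e) (trans (cong -_ (x≗z e)) (sym (antisymmetric z z-ker e)))

open import Data.Nat using (_≤_; _+_)

proposition3p3 : (G : Graph) → Connected G → (∀ v → 2 ≤ degree G v) →
    AtLeastTwoCycles G →
    Σ ℕ (λ d → (d + n G ≡ m G + 1) × DimKerBminusI≡ G d)
proposition3p3 G conn _ cycles@(c₁ , _) =
  let d , d+n≡m+1 , flowBasis = cycleSpace G (src G (Cycle.first c₁)) conn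
  in d , d+n≡m+1 , transferBasis (kernelRestrictionIso G conn (twoCycles⇒n≢m G conn cycles)) flowBasis
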